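{- Let $(\delta,K_1,K_2,C_0,C_1)$ be admissible parameters satisfying Case IIB and let $M$ be a magic distance. Let $\mathbf C$ be either a cycle with distances $d_0,d_1,d_2,x_1,\dots,x_k$ such that either $\mathbf C$ has even perimeter and $d_0+d_1+d_2>(C_0-1)+\sum x_i$, or $\mathbf C$ has odd perimeter and $d_0+d_1+d_2>(C_1-1)+\sum x_i$; or, when $\delta=5$, the cycle $(5,5,5,5,5)$. If $\mathbf C$ has at least 4 vertices, then $\mathbf C$ has a tension.
   Context: A $\delta$-edge-labelled cycle is a cycle graph (at least 3 vertices) with edge labels in $\{1,\dots,\delta\}$; it "has distances $d_1,\dots,d_m$" if its edges can be listed in some (arbitrary) order with these labels; its perimeter is the sum of labels; $(5,5,5,5,5)$ is the 5-cycle with all labels 5. Two edges are neighbouring if they share a vertex. Parameters: integers with $3\le\delta<\infty$, $1\le K_1\le K_2\le\delta$, $2\delta+2\le C_0,C_1\le3\delta+2$, $C_0$ even, $C_1$ odd; $C=\min(C_0,C_1)$, $C'=\max(C_0,C_1)$. Case IIB (admissible) means: $C\le2\delta+K_1$, $C=2K_1+2K_2+1$, $K_1+K_2\ge\delta$, $K_1+2K_2\le2\delta-1$, $C'>C+1$, $K_1=K_2$ and $3K_2=2\delta-1$. Magic distance (in Case II): $M\in\{1,\dots,\delta\}$ with $\max(K_1,\lceil\delta/2\rceil)\le M\le\min(K_2,\lfloor(C-\delta-1)/2\rfloor)$. Operation: $x\oplus y=|x-y|$ if $|x-y|>M$; otherwise $\min(x+y,C-1-x-y)$ if this is $<M$;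 otherwise $M$. A cycle has a tension if it has neighbouring edges with labels $a,b$ such that $a\oplus b\ne M$. -}

module Defs where

open import Data.Nat using (ℕ; zero; suc; _+_; _*_; _∸_; _≤_; _<_; _⊓_; _⊔_; _/_; ∣_-_∣; _<ᵇ_)
open import Data.Nat.Divisibility using (_∣_)
open import Data.Bool using (if_then_else_)
open import Data.List using (List; []; _∷_; _++_; length)
open import Data.Nat.ListAction using (sum)
open import Data.List.Relation.Unary.All using (All)
open import Data.List.Relation.Unary.Any using (Any)
open import Data.Product using (_×_; _,_)
open import Relation.Binary.PropositionalEquality using (_≡_; _≢_)
open import Relation.Nullary using (¬_)

record Admissible (δ K₁ K₂ C₀ C₁ : ℕ) : Set where
  field
    δ≥3   : 3 ≤ δ
    K₁≥1  : 1 ≤ K₁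
    K₁≤K₂ : K₁ ≤ K₂
    K₂≤δ  : K₂ ≤ δ
    C₀-lo : 2 * δ + 2 ≤ C₀
    C₀-hi : C₀ ≤ 3 * δ + 2
    C₁-lo : 2 * δ + 2 ≤ C₁
    C₁-hi : C₁ ≤ 3 * δ + 2
    C₀-even : 2 ∣ C₀
    C₁-odd  : ¬ (2 ∣ C₁)

cMin : ℕ → ℕ → ℕ
cMin C₀ C₁ = C₀ ⊓ C₁

cMax : ℕ → ℕ → ℕ
cMax C₀ C₁ = C₀ ⊔ C₁

record CaseIIB (δ K₁ K₂ C₀ C₁ : ℕ) : Set where
  field
    c1 : cMin C₀ C₁ ≤ 2 * δ + K₁
    c2 : cMin C₀ C₁ ≡ 2 * K₁ + 2 * K₂ + 1
    c3 : δ ≤ K₁ + K₂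
    c4 : K₁ + 2 * K₂ ≤ 2 * δ ∸ 1
    c5 : cMin C₀ C₁ + 1 < cMax C₀ C₁
    c6 : K₁ ≡ K₂
    c7 : 3 * K₂ ≡ 2 * δ ∸ 1

-- Magic distance; ⌈δ/2⌉ = (δ+1)/2, ⌊(C-δ-1)/2⌋ = (C∸δ∸1)/2 (C-δ-1 ≥ δ+1 > 0).
record MagicDistance (δ K₁ K₂ C₀ C₁ M : ℕ) : Set where
  field
    M≥1   : 1 ≤ M
    M≤δ   : M ≤ δ
    K₁≤M  : K₁ ≤ M
    ceil≤M : (δ + 1) / 2 ≤ M
    M≤K₂  : M ≤ K₂
    M≤floor : M ≤ (cMin C₀ C₁ ∸ δ ∸ 1) / 2

oplus : (M C x y : ℕ) → ℕ
oplus M C x y =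
  if M <ᵇ ∣ x - y ∣ then ∣ x - y ∣
  else (if ((x + y) ⊓ (C ∸ 1 ∸ x ∸ y)) <ᵇ M
        then (x + y) ⊓ (C ∸ 1 ∸ x ∸ y)
        else M)

-- A δ-edge-labelled cycle is given by the list of its edge labels in cyclic
-- order: edge i joins vertices i and i+1 (mod n); n = length ≥ 3.
IsCycle : ℕ → List ℕ → Set
IsCycle δ L = (3 ≤ length L) × All (λ l → (1 ≤ l) × (l ≤ δ)) L

adjPairs : List ℕ → List (ℕ × ℕ)
adjPairs (a ∷ b ∷ rest) = (a , b) ∷ adjPairs (b ∷ rest)
adjPairs _ = []

neighbourPairs : List ℕ → List (ℕ × ℕ)
neighbourPairs [] = []
neighbourPairs (x ∷ xs) = adjPairs ((x ∷ xs) ++ (x ∷ []))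

perimeter : List ℕ → ℕ
perimeter = sum

-- "C has distances ds": edge labels can be listed in the order ds.
open import Data.List.Relation.Binary.Permutation.Propositional using (_↭_)
HasDistances : List ℕ → List ℕ → Set
HasDistances L ds = L ↭ ds

HasTension : (M C : ℕ) → List ℕ → Set
HasTension M C L = Any (λ p → oplus M C (Data.Product.proj₁ p) (Data.Product.proj₂ p) ≢ M) (neighbourPairs L)

five5 : List ℕ
five5 = 5 ∷ 5 ∷ 5 ∷ 5 ∷ 5 ∷ []

-- In Case IIB we have K₁ = K₂ = M =: K, C = 4K + 1 and 2δ = 3K + 1, so a pair of
-- neighbouring labels a, b is free of tension only if |a − b| ≤ K and a + b ≤ 3K.
-- If d₀ + d₁ + d₂ > 4K + Σ xᵢ, then every dᵢ is at least K and Σ xᵢ < K, so the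
-- cycle has exactly three big edges (labels ≥ K) and some small one. Summing the
-- pairwise constraints over all neighbouring pairs bounds 2(d₀ + d₁ + d₂) by
-- 2 Σ xᵢ + (6 + b) K, where b ≤ 2 counts neighbouring pairs of big edges; this
-- contradicts the hypothesis. The cycle (5,5,5,5,5) fails a + b ≤ 3K = 9 at once.
module Submission where

open import Defs
open import Data.Nat using (ℕ; _+_; _∸_; _≤_; _<_)
open import Data.Nat.Divisibility using (_∣_)
open import Data.List using (List; _∷_; length)
open import Data.Nat.ListAction using (sum)
open import Data.Product using (_×_; ∃)
open import Data.Sum using (_⊎_)
open import Relation.Binary.PropositionalEquality using (_≡_)
open import Relation.Nullary using (¬_)

open import Data.Nat using (suc; _*_; z≤n; s≤s; _≤?_; _⊓_; _<ᵇ_; ∣_-_∣; _≟_)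
open import Data.Nat.Properties
open import Data.Nat.ListAction.Properties using (sum-↭)
open import Data.Nat.Tactic.RingSolver using (solve-∀)
open import Data.Bool using (Bool; true; false; if_then_else_; T)
import Data.Bool as Bool
open import Data.Unit using (tt)
open import Data.List using ([]; _++_; map)
open import Data.List.Relation.Unary.All as All using (All; []; _∷_)
open import Data.List.Relation.Unary.All.Properties using (¬All⇒Any¬)
open import Data.List.Relation.Unary.Any as Any using (Any; here; there)
open import Data.List.Membership.Propositional using (_∈_)
open import Data.List.Membership.Propositional.Properties using (∈-++⁺ˡ)
open import Data.List.Relation.Binary.Permutation.Propositional using (_↭_; ↭-sym)
open import Data.List.Relation.Binary.Permutation.Propositional.Properties
  using (∈-resp-↭; ↭-length; map⁺)
open import Data.Product using (_,_; proj₁; proj₂; uncurry)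
open import Data.Sum using (inj₁; inj₂)
open import Function using (_∘_; case_of_)
open import Relation.Nullary using (does; yes; no; contradiction)
open import Relation.Nullary.Decidable using (dec-true; dec-false; from-no)
open import Relation.Binary.PropositionalEquality using (_≢_; refl; sym; trans; cong; cong₂; subst; subst₂)

oplus≡M⇒bounds : ∀ M C a b → oplus M C a b ≡ M →
                 ∣ a - b ∣ ≤ M × M ≤ (a + b) ⊓ (C ∸ 1 ∸ a ∸ b)
oplus≡M⇒bounds M C a b eq with M <ᵇ ∣ a - b ∣ in far
... | true = contradiction (<ᵇ⇒< M _ (subst T (sym far) tt)) (<-irrefl (sym eq))
... | false with (a + b) ⊓ (C ∸ 1 ∸ a ∸ b) <ᵇ M in near
...   | true = contradiction (<ᵇ⇒< _ M (subst T (sym near) tt)) (<-irrefl eq)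
...   | false = ≮⇒≥ (subst T far ∘ <⇒<ᵇ) , ≮⇒≥ (subst T near ∘ <⇒<ᵇ)

GoodPair : ℕ → ℕ × ℕ → Set
GoodPair K (a , b) = a ≤ b + K × b ≤ a + K × a + b ≤ 3 * K

oplus≡K⇒goodPair : ∀ {K C a b} → 1 ≤ K → C ∸ 1 ≡ 4 * K →
                   oplus K C a b ≡ K → GoodPair K (a , b)
oplus≡K⇒goodPair {K} {C} {a} {b} K≥1 C∸1≡4K eq =
  ≤-trans (m≤n+∣m-n∣ a b) (+-monoʳ-≤ b close) ,
  ≤-trans (m≤n+∣n-m∣ b a) (+-monoʳ-≤ a close) ,
  +-cancelˡ-≤ K (a + b) (3 * K) (begin
    K + (a + b)  ≤⟨ m≤o∸n⇒m+n≤o K (<⇒≤ a+b<4K) K≤rest ⟩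
    4 * K        ≡⟨ 4K≡K+3K K ⟩
    K + 3 * K    ∎)
  where
  open ≤-Reasoning
  close : ∣ a - b ∣ ≤ K
  close = proj₁ (oplus≡M⇒bounds K C a b eq)
  K≤rest : K ≤ 4 * K ∸ (a + b)
  K≤rest = subst (K ≤_) (trans (cong (λ n → n ∸ a ∸ b) C∸1≡4K) (∸-+-assoc (4 * K) a b))
                 (≤-trans (proj₂ (oplus≡M⇒bounds K C a b eq)) (m⊓n≤n (a + b) _))
  a+b<4K : a + b < 4 * K
  a+b<4K = m∸n≢0⇒n<m (λ e → 1+n≰n (≤-trans K≥1 (subst (K ≤_) e K≤rest)))
  4K≡K+3K : ∀ k → 4 * k ≡ k + 3 * k
  4K≡K+3K = solve-∀

pairSum : (ℕ → ℕ → ℕ) → List (ℕ × ℕ) → ℕ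
pairSum g [] = 0
pairSum g ((a , b) ∷ ps) = g a b + pairSum g ps

pairSum-+ : ∀ F G ps → pairSum (λ a b → F a b + G a b) ps ≡ pairSum F ps + pairSum G ps
pairSum-+ F G [] = refl
pairSum-+ F G ((a , b) ∷ ps) =
  trans (cong (F a b + G a b +_) (pairSum-+ F G ps)) (interchange (F a b) (G a b) _ _)
  where
  interchange : ∀ w x y z → w + x + (y + z) ≡ w + y + (x + z)
  interchange = solve-∀

pairSum-*ʳ : ∀ F c ps → pairSum (λ a b → F a b * c) ps ≡ pairSum F ps * c
pairSum-*ʳ F c [] = refl
pairSum-*ʳ F c ((a , b) ∷ ps) =
  trans (cong (F a b * c +_) (pairSum-*ʳ F c ps)) (sym (*-distribʳ-+ c (F a b) _))

pairSum-mono-≤ : ∀ {F G} ps → All (λ p → uncurry F p ≤ uncurry G p) ps →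
                 pairSum F ps ≤ pairSum G ps
pairSum-mono-≤ [] [] = z≤n
pairSum-mono-≤ ((a , b) ∷ ps) (le ∷ les) = +-mono-≤ le (pairSum-mono-≤ ps les)

pairSum-mono-< : ∀ {F G} ps → All (λ p → uncurry F p ≤ uncurry G p) ps →
                 Any (λ p → uncurry F p < uncurry G p) ps → pairSum F ps < pairSum G ps
pairSum-mono-< ((a , b) ∷ ps) (_ ∷ les) (here lt) = +-mono-<-≤ lt (pairSum-mono-≤ ps les)
pairSum-mono-< ((a , b) ∷ ps) (le ∷ les) (there lt) = +-mono-≤-< le (pairSum-mono-< ps les lt)

pairSum-adjPairs : ∀ f a rest z → pairSum (λ u v → f u + f v) (adjPairs (a ∷ rest ++ z ∷ []))
                                  ≡ f a + 2 * sum (map f rest) + f z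
pairSum-adjPairs f a [] z = trans (+-identityʳ (f a + f z)) (cong (_+ f z) (sym (+-identityʳ (f a))))
pairSum-adjPairs f a (r ∷ rest) z =
  trans (cong (f a + f r +_) (pairSum-adjPairs f r rest z)) (regroup (f a) (f r) _ (f z))
  where
  regroup : ∀ x y s w → x + y + (y + 2 * s + w) ≡ x + 2 * (y + s) + w
  regroup = solve-∀

pairSum-neighbourPairs : ∀ f L → pairSum (λ u v → f u + f v) (neighbourPairs L) ≡ 2 * sum (map f L)
pairSum-neighbourPairs f [] = refl
pairSum-neighbourPairs f (x ∷ xs) = trans (pairSum-adjPairs f x xs x) (regroup (f x) _)
  where
  regroup : ∀ y s → y + 2 * s + y ≡ 2 * (y + s)
  regroup = solve-∀

Straddles : (ℕ → Bool) → ℕ × ℕ → Set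
Straddles c (a , b) = c a ≢ c b

adjPairs-straddle : ∀ c a rest {y} → y ∈ rest → c y ≢ c a → Any (Straddles c) (adjPairs (a ∷ rest))
adjPairs-straddle c a (b ∷ rest) (here refl) cb≢ca = here (cb≢ca ∘ sym)
adjPairs-straddle c a (b ∷ rest) (there y∈rest) cy≢ca with c a Bool.≟ c b
... | no ca≢cb = here ca≢cb
... | yes ca≡cb = there (adjPairs-straddle c b rest y∈rest (λ e → cy≢ca (trans e (sym ca≡cb))))

neighbourPairs-straddleHead : ∀ c l ls {y} → y ∈ l ∷ ls → c y ≢ c l →
                              Any (Straddles c) (neighbourPairs (l ∷ ls))
neighbourPairs-straddleHead c l ls (here refl) cy≢cl = contradiction refl cy≢cl
neighbourPairs-straddleHead c l ls (there y∈ls) cy≢cl =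
  adjPairs-straddle c l (ls ++ l ∷ []) (∈-++⁺ˡ y∈ls) cy≢cl

neighbourPairs-straddle : ∀ c L {u v} → u ∈ L → v ∈ L → c u ≢ c v →
                          Any (Straddles c) (neighbourPairs L)
neighbourPairs-straddle c (l ∷ ls) {u} u∈L v∈L cu≢cv with c u Bool.≟ c l
... | no cu≢cl = neighbourPairs-straddleHead c l ls u∈L cu≢cl
... | yes cu≡cl = neighbourPairs-straddleHead c l ls v∈L (λ cv≡cl → cu≢cv (trans cu≡cl (sym cv≡cl)))

module BigSmall (K : ℕ) where

  isBig : ℕ → Bool
  isBig l = does (K ≤? l)

  bigCount bigPart smallPart : ℕ → ℕ
  bigCount l = if isBig l then 1 else 0
  bigPart l = if isBig l then l else 0
  smallPart l = if isBig l then 0 else l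

  isBig-big : ∀ {l} → K ≤ l → isBig l ≡ true
  isBig-big {l} = dec-true (K ≤? l)

  isBig-small : ∀ {l} → l < K → isBig l ≡ false
  isBig-small {l} = dec-false (K ≤? l) ∘ <⇒≱

  parts-big : ∀ {l} → K ≤ l → bigCount l ≡ 1 × bigPart l ≡ l × smallPart l ≡ 0
  parts-big K≤l rewrite isBig-big K≤l = refl , refl , refl

  parts-small : ∀ {l} → l < K → bigCount l ≡ 0 × bigPart l ≡ 0 × smallPart l ≡ l
  parts-small l<K rewrite isBig-small l<K = refl , refl , refl

  sums-small : ∀ xs → All (_< K) xs →
               sum (map bigCount xs) ≡ 0 × sum (map bigPart xs) ≡ 0 × sum (map smallPart xs) ≡ sum xs
  sums-small [] [] = refl , refl , refl
  sums-small (x ∷ xs) (x<K ∷ xs<K)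
    with parts-small x<K | sums-small xs xs<K
  ... | c , b , s | cs , bs , ss rewrite c | b | s | cs | bs | ss = refl , refl , refl

  sums-threeBig : ∀ {a b c} xs → K ≤ a → K ≤ b → K ≤ c → All (_< K) xs →
    sum (map bigCount (a ∷ b ∷ c ∷ xs)) ≡ 3 ×
    sum (map bigPart (a ∷ b ∷ c ∷ xs)) ≡ a + b + c ×
    sum (map smallPart (a ∷ b ∷ c ∷ xs)) ≡ sum xs
  sums-threeBig {a} {b} {c} xs K≤a K≤b K≤c xs<K
    with parts-big K≤a | parts-big K≤b | parts-big K≤c | sums-small xs xs<K
  ... | ca , ba , sa | cb , bb , sb | cc , bc , sc | cs , bs , ss
    rewrite ca | ba | sa | cb | bb | sb | cc | bc | sc | cs | bs | ss | +-identityʳ c =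
    refl , sym (+-assoc a b c) , refl

  goodPair-parts : ∀ a b → GoodPair K (a , b) →
    bigPart a + bigPart b ≤ smallPart a + smallPart b + (bigCount a + bigCount b + bigCount a * bigCount b) * K
  goodPair-parts a b (a≤b+K , b≤a+K , a+b≤3K) with isBig a | isBig b
  ... | true  | true  = a+b≤3K
  ... | true  | false rewrite +-identityʳ a | +-identityʳ K = a≤b+K
  ... | false | true  rewrite +-identityʳ a | +-identityʳ K = b≤a+K
  ... | false | false = z≤n

  bigCount-pair : ∀ a b → bigCount a * bigCount b * 2 ≤ bigCount a + bigCount b
  bigCount-pair a b with isBig a | isBig b
  ... | true  | true  = ≤-refl
  ... | true  | false = z≤n
  ... | false | _     = z≤n

  bigCount-straddle : ∀ a b → Straddles isBig (a , b) → bigCount a * bigCount b * 2 < bigCount a + bigCount b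
  bigCount-straddle a b straddles with isBig a | isBig b
  ... | true  | true  = contradiction refl straddles
  ... | true  | false = ≤-refl
  ... | false | true  = ≤-refl
  ... | false | false = contradiction refl straddles

  -- With n big edges and bb neighbouring pairs of big edges, the pairwise bounds sum to
  -- 2 Σ bigPart ≤ 2 Σ smallPart + (2n + bb) K, and a straddling pair forces bb < n.
  bigPart-bound : ∀ L → All (GoodPair K) (neighbourPairs L) → Any (Straddles isBig) (neighbourPairs L) →
    2 * sum (map bigPart L) + K ≤ 2 * sum (map smallPart L) + 3 * sum (map bigCount L) * K
  bigPart-bound L good straddle = begin
    2 * sum (map bigPart L) + K          ≤⟨ +-monoˡ-≤ K pairwise ⟩
    2 * S + (2 * n + bb) * K + K         ≡⟨ regroup (2 * S) n bb K ⟩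
    2 * S + (2 * n + suc bb) * K         ≤⟨ +-monoʳ-≤ (2 * S) (*-monoˡ-≤ K (+-monoʳ-≤ (2 * n) bb<n)) ⟩
    2 * S + (2 * n + n) * K              ≡⟨ cong (λ m → 2 * S + m * K) (+-comm (2 * n) n) ⟩
    2 * S + 3 * n * K                    ∎
    where
    open ≤-Reasoning
    ps : List (ℕ × ℕ)
    ps = neighbourPairs L
    S n bb : ℕ
    S = sum (map smallPart L)
    n = sum (map bigCount L)
    bb = pairSum (λ a b → bigCount a * bigCount b) ps
    pairwise : 2 * sum (map bigPart L) ≤ 2 * S + (2 * n + bb) * K
    pairwise = begin
      2 * sum (map bigPart L)
        ≡⟨ pairSum-neighbourPairs bigPart L ⟨
      pairSum (λ a b → bigPart a + bigPart b) ps
        ≤⟨ pairSum-mono-≤ ps (All.map (λ { {a , b} → goodPair-parts a b }) good) ⟩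
      pairSum (λ a b → smallPart a + smallPart b + (bigCount a + bigCount b + bigCount a * bigCount b) * K) ps
        ≡⟨ pairSum-+ _ _ ps ⟩
      pairSum (λ a b → smallPart a + smallPart b) ps
        + pairSum (λ a b → (bigCount a + bigCount b + bigCount a * bigCount b) * K) ps
        ≡⟨ cong₂ _+_ (pairSum-neighbourPairs smallPart L) (pairSum-*ʳ _ K ps) ⟩
      2 * S + pairSum (λ a b → bigCount a + bigCount b + bigCount a * bigCount b) ps * K
        ≡⟨ cong (λ m → 2 * S + m * K) (trans (pairSum-+ _ _ ps)
                                             (cong (_+ bb) (pairSum-neighbourPairs bigCount L))) ⟩
      2 * S + (2 * n + bb) * K ∎
    bb<n : bb < n
    bb<n = *-cancelʳ-< 2 bb n (begin-strict
      bb * 2                                               ≡⟨ pairSum-*ʳ _ 2 ps ⟨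
      pairSum (λ a b → bigCount a * bigCount b * 2) ps      <⟨ pairSum-mono-< ps (All.universal (uncurry bigCount-pair) ps)
                                                                 (Any.map (λ { {a , b} → bigCount-straddle a b }) straddle) ⟩
      pairSum (λ a b → bigCount a + bigCount b) ps          ≡⟨ pairSum-neighbourPairs bigCount L ⟩
      2 * n                                                 ≡⟨ *-comm 2 n ⟩
      n * 2                                                 ∎)
    regroup : ∀ s m c k → s + (2 * m + c) * k + k ≡ s + (2 * m + suc c) * k
    regroup = solve-∀

excess⇒big : ∀ {K δ a b c} → δ + δ ≡ 3 * K + 1 → b ≤ δ → c ≤ δ → 4 * K < a + (b + c) → K ≤ a
excess⇒big {K} {δ} {a} {b} {c} δ+δ≡ b≤δ c≤δ excess = +-cancelʳ-≤ (3 * K + 1) K a (begin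
  K + (3 * K + 1)  ≡⟨ regroup K ⟩
  suc (4 * K)      ≤⟨ excess ⟩
  a + (b + c)      ≤⟨ +-monoʳ-≤ a (+-mono-≤ b≤δ c≤δ) ⟩
  a + (δ + δ)      ≡⟨ cong (a +_) δ+δ≡ ⟩
  a + (3 * K + 1)  ∎)
  where
  open ≤-Reasoning
  regroup : ∀ k → k + (3 * k + 1) ≡ suc (4 * k)
  regroup = solve-∀

-- Here 2 ≤ K is needed: the hypothesis only gives 2 Σ xᵢ ≤ K + 1.
excess⇒rest< : ∀ {K δ a b c s} → 2 ≤ K → δ + δ ≡ 3 * K + 1 → a ≤ δ → b ≤ δ → c ≤ δ →
               4 * K + s < a + b + c → s < K
excess⇒rest< {K} {δ} {a} {b} {c} {s} K≥2 δ+δ≡ a≤δ b≤δ c≤δ excess =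
  ≰⇒> (λ K≤s → <⇒≱ K≥2 (K≤1 K≤s))
  where
  open ≤-Reasoning
  ninefold : ∀ k → 3 * (3 * k + 1) ≡ 1 + (9 * k + 2)
  ninefold = solve-∀
  sixfold : ∀ k → k + (9 * k + 2) ≡ 2 * suc (4 * k + k)
  sixfold = solve-∀
  triple : ∀ d → 2 * (d + d + d) ≡ 3 * (d + d)
  triple = solve-∀
  excess≤3δ : suc (4 * K + s) ≤ δ + δ + δ
  excess≤3δ = ≤-trans excess (+-mono-≤ (+-mono-≤ a≤δ b≤δ) c≤δ)
  K≤1 : K ≤ s → K ≤ 1
  K≤1 K≤s = +-cancelʳ-≤ (9 * K + 2) K 1 (begin
    K + (9 * K + 2)      ≡⟨ sixfold K ⟩
    2 * suc (4 * K + K)  ≤⟨ *-monoʳ-≤ 2 (≤-trans (s≤s (+-monoʳ-≤ (4 * K) K≤s)) excess≤3δ) ⟩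
    2 * (δ + δ + δ)      ≡⟨ triple δ ⟩
    3 * (δ + δ)          ≡⟨ cong (3 *_) δ+δ≡ ⟩
    3 * (3 * K + 1)      ≡⟨ ninefold K ⟩
    1 + (9 * K + 2)      ∎)

excess-contradiction : ∀ {K s D} → 4 * K + s < D → ¬ (2 * D + K ≤ 2 * s + 3 * 3 * K)
excess-contradiction {K} {s} {D} excess bound = 1+n≰n (m+n≤o⇒n≤o 1 (begin
  2 + (2 * s + 3 * 3 * K)    ≡⟨ regroup K s ⟩
  2 * suc (4 * K + s) + K    ≤⟨ +-monoˡ-≤ K (*-monoʳ-≤ 2 excess) ⟩
  2 * D + K                  ≤⟨ bound ⟩
  2 * s + 3 * 3 * K          ∎))
  where
  open ≤-Reasoning
  regroup : ∀ k t → 2 + (2 * t + 3 * 3 * k) ≡ 2 * suc (4 * k + t) + k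
  regroup = solve-∀

sum<⇒All< : ∀ {K} xs → sum xs < K → All (_< K) xs
sum<⇒All< [] _ = []
sum<⇒All< (x ∷ xs) sum<K =
  ≤-<-trans (m≤m+n x (sum xs)) sum<K ∷ sum<⇒All< xs (≤-<-trans (m≤n+m (sum xs) x) sum<K)

excessCycle-notGood : ∀ {K δ L d₀ d₁ d₂ xs} → 2 ≤ K → δ + δ ≡ 3 * K + 1 →
  All (_≤ δ) L → L ↭ d₀ ∷ d₁ ∷ d₂ ∷ xs → 4 ≤ length L →
  4 * K + sum xs < d₀ + d₁ + d₂ → ¬ All (GoodPair K) (neighbourPairs L)
excessCycle-notGood {xs = []} _ _ _ L↭ps len≥4 _ _ = 1+n≰n (subst (4 ≤_) (↭-length L↭ps) len≥4)
excessCycle-notGood {K} {δ} {L} {d₀} {d₁} {d₂} {x ∷ xs} K≥2 δ+δ≡ L≤δ L↭ps _ excess good =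
  excess-contradiction excess (begin
    2 * (d₀ + d₁ + d₂) + K                                   ≡⟨ cong (λ B → 2 * B + K) B≡D ⟨
    2 * sum (map bigPart L) + K                               ≤⟨ bigPart-bound L good straddle ⟩
    2 * sum (map smallPart L) + 3 * sum (map bigCount L) * K  ≡⟨ cong₂ (λ S n → 2 * S + 3 * n * K) S≡s n≡3 ⟩
    2 * sum (x ∷ xs) + 3 * 3 * K                              ∎)
  where
  open BigSmall K
  open ≤-Reasoning
  sum-map-↭ : ∀ f → sum (map f L) ≡ sum (map f (d₀ ∷ d₁ ∷ d₂ ∷ x ∷ xs))
  sum-map-↭ f = sum-↭ (map⁺ f L↭ps)
  inL : ∀ {y} → y ∈ d₀ ∷ d₁ ∷ d₂ ∷ x ∷ xs → y ∈ L
  inL = ∈-resp-↭ (↭-sym L↭ps)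
  d₀≤δ : d₀ ≤ δ
  d₀≤δ = All.lookup L≤δ (inL (here refl))
  d₁≤δ : d₁ ≤ δ
  d₁≤δ = All.lookup L≤δ (inL (there (here refl)))
  d₂≤δ : d₂ ≤ δ
  d₂≤δ = All.lookup L≤δ (inL (there (there (here refl))))
  4K<D : 4 * K < d₀ + d₁ + d₂
  4K<D = ≤-<-trans (m≤m+n (4 * K) _) excess
  rotate₁ : ∀ a b c → a + b + c ≡ b + (a + c)
  rotate₁ = solve-∀
  rotate₂ : ∀ a b c → a + b + c ≡ c + (a + b)
  rotate₂ = solve-∀
  K≤d₀ : K ≤ d₀
  K≤d₀ = excess⇒big δ+δ≡ d₁≤δ d₂≤δ (subst (4 * K <_) (+-assoc d₀ d₁ d₂) 4K<D)
  K≤d₁ : K ≤ d₁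
  K≤d₁ = excess⇒big δ+δ≡ d₀≤δ d₂≤δ (subst (4 * K <_) (rotate₁ d₀ d₁ d₂) 4K<D)
  K≤d₂ : K ≤ d₂
  K≤d₂ = excess⇒big δ+δ≡ d₀≤δ d₁≤δ (subst (4 * K <_) (rotate₂ d₀ d₁ d₂) 4K<D)
  rest<K : All (_< K) (x ∷ xs)
  rest<K = sum<⇒All< (x ∷ xs) (excess⇒rest< K≥2 δ+δ≡ d₀≤δ d₁≤δ d₂≤δ excess)
  sums : sum (map bigCount (d₀ ∷ d₁ ∷ d₂ ∷ x ∷ xs)) ≡ 3 ×
         sum (map bigPart (d₀ ∷ d₁ ∷ d₂ ∷ x ∷ xs)) ≡ d₀ + d₁ + d₂ ×
         sum (map smallPart (d₀ ∷ d₁ ∷ d₂ ∷ x ∷ xs)) ≡ sum (x ∷ xs)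
  sums = sums-threeBig (x ∷ xs) K≤d₀ K≤d₁ K≤d₂ rest<K
  n≡3 : sum (map bigCount L) ≡ 3
  n≡3 = trans (sum-map-↭ bigCount) (proj₁ sums)
  B≡D : sum (map bigPart L) ≡ d₀ + d₁ + d₂
  B≡D = trans (sum-map-↭ bigPart) (proj₁ (proj₂ sums))
  S≡s : sum (map smallPart L) ≡ sum (x ∷ xs)
  S≡s = trans (sum-map-↭ smallPart) (proj₂ (proj₂ sums))
  straddle : Any (Straddles isBig) (neighbourPairs L)
  straddle = neighbourPairs-straddle isBig L (inL (here refl)) (inL (there (there (there (here refl)))))
    (subst₂ _≢_ (sym (isBig-big K≤d₀)) (sym (isBig-small (All.head rest<K))) λ ())

record CaseIIBValues (δ K C M : ℕ) : Set where
  field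
    M≡K    : M ≡ K
    C∸1≡4K : C ∸ 1 ≡ 4 * K
    δ+δ≡   : δ + δ ≡ 3 * K + 1
    K≥1    : 1 ≤ K
    K≥2    : 2 ≤ K

caseIIB-values : ∀ {δ K₁ K₂ C₀ C₁ M} → Admissible δ K₁ K₂ C₀ C₁ → CaseIIB δ K₁ K₂ C₀ C₁ →
                 MagicDistance δ K₁ K₂ C₀ C₁ M → CaseIIBValues δ K₁ (cMin C₀ C₁) M
caseIIB-values {δ} {K} adm record { c2 = C≡4K+1 ; c6 = refl ; c7 = 3K≡2δ∸1 } magic = record
  { M≡K    = ≤-antisym M≤K₂ K₁≤M
  ; C∸1≡4K = trans (cong (_∸ 1) C≡4K+1) (trans (m+n∸n≡m (2 * K + 2 * K) 1) (double K))
  ; δ+δ≡   = δ+δ≡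
  ; K≥1    = K₁≥1
  ; K≥2    = ≰⇒> (λ K≤1 → from-no (6 ≤? 4)
               (≤-trans (+-mono-≤ δ≥3 δ≥3) (subst (_≤ 4) (sym δ+δ≡) (+-monoˡ-≤ 1 (*-monoʳ-≤ 3 K≤1)))))
  }
  where
  open Admissible adm using (δ≥3; K₁≥1)
  open MagicDistance magic using (K₁≤M; M≤K₂)
  double : ∀ k → 2 * k + 2 * k ≡ 4 * k
  double = solve-∀
  1≤2δ : 1 ≤ 2 * δ
  1≤2δ = ≤-trans (s≤s z≤n) (≤-trans δ≥3 (m≤m+n δ _))
  δ+δ≡ : δ + δ ≡ 3 * K + 1
  δ+δ≡ = sym (trans (trans (cong (_+ 1) 3K≡2δ∸1) (m∸n+n≡m 1≤2δ)) (cong (δ +_) (+-identityʳ δ)))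

excess-weaken : ∀ {K C C' s D} → C ∸ 1 ≡ 4 * K → C ≤ C' → (C' ∸ 1) + s < D → 4 * K + s < D
excess-weaken {C' = C'} {s} C∸1≡4K C≤C' = ≤-<-trans (+-monoˡ-≤ s (subst (_≤ C' ∸ 1) C∸1≡4K (∸-monoˡ-≤ 1 C≤C')))

fiveCycle-notGood : ∀ {K} → 5 + 5 ≡ 3 * K + 1 → ¬ All (GoodPair K) (neighbourPairs five5)
fiveCycle-notGood {K} 10≡3K+1 (good ∷ _) =
  1+n≰n (≤-trans (≤-reflexive (trans (+-comm 1 (3 * K)) (sym 10≡3K+1))) (proj₂ (proj₂ good)))

mainTheorem14 : (δ K₁ K₂ C₀ C₁ M : ℕ) →
    Admissible δ K₁ K₂ C₀ C₁ → CaseIIB δ K₁ K₂ C₀ C₁ →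
    MagicDistance δ K₁ K₂ C₀ C₁ M →
    (L : List ℕ) → IsCycle δ L →
    ((∃ λ d₀ → ∃ λ d₁ → ∃ λ d₂ → ∃ λ (xs : List ℕ) →
        HasDistances L (d₀ ∷ d₁ ∷ d₂ ∷ xs) ×
        (((2 ∣ perimeter L) × ((C₀ ∸ 1) + sum xs < d₀ + d₁ + d₂))
         ⊎ ((¬ (2 ∣ perimeter L)) × ((C₁ ∸ 1) + sum xs < d₀ + d₁ + d₂))))
     ⊎ ((δ ≡ 5) × (L ≡ five5))) →
    4 ≤ length L →
    HasTension M (cMin C₀ C₁) L
mainTheorem14 δ K₁ K₂ C₀ C₁ M adm iib magic L (_ , labels) cycle len≥4 =
  ¬All⇒Any¬ (λ p → oplus M C (proj₁ p) (proj₂ p) ≟ M) (neighbourPairs L) noTension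
  where
  open CaseIIBValues (caseIIB-values adm iib magic)
  C : ℕ
  C = cMin C₀ C₁
  L≤δ : All (_≤ δ) L
  L≤δ = All.map proj₂ labels
  good : ∀ {ps} → All (λ p → oplus M C (proj₁ p) (proj₂ p) ≡ M) ps → All (GoodPair K₁) ps
  good = All.map (λ { {a , b} → oplus≡K⇒goodPair {C = C} K≥1 C∸1≡4K ∘ subst (λ m → oplus m C a b ≡ m) M≡K })
  noTension : ¬ All (λ p → oplus M C (proj₁ p) (proj₂ p) ≡ M) (neighbourPairs L)
  noTension allK = case cycle of λ where
    (inj₁ (_ , _ , _ , _ , L↭ , inj₁ (_ , excess))) →
      excessCycle-notGood K≥2 δ+δ≡ L≤δ L↭ len≥4 (excess-weaken {K = K₁} C∸1≡4K (m⊓n≤m C₀ C₁) excess) (good allK)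
    (inj₁ (_ , _ , _ , _ , L↭ , inj₂ (_ , excess))) →
      excessCycle-notGood K≥2 δ+δ≡ L≤δ L↭ len≥4 (excess-weaken {K = K₁} C∸1≡4K (m⊓n≤n C₀ C₁) excess) (good allK)
    (inj₂ (refl , refl)) → fiveCycle-notGood δ+δ≡ (good allK)
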